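{- Let $\mathbf{w}$ be a word over $\{r,c\}$ of length $k$ and $n\ge1$. Then for every decomposition in $\mathrm{BSD}(\mathbf{w},n)$, each of the diagonals numbered $1,2,\dots,n+k$ contains exactly one head of a strip, and the positions of the heads uniquely determine the border-strip decomposition.
   Context: Diagrams are in English convention (rows top to bottom, columns left to right); the content of the box in row $i$, column $j$ is $j-i$, and a diagonal is the set of boxes of a given content. A border strip is a set of boxes forming a connected skew shape with no $2\times2$ square; its head is its box of maximal content. For a word $\mathbf{w}$ over $\{r,c\}$ and $n\ge1$, the simple diagram $(\mathbf{w},n)$ is defined recursively: $(\emptyset,n)$ is the $n\times n$ square; $(c\mathbf{w},n)$ is obtained from $(\mathbf{w},n)$ by adjoining a new column of $n$ boxes immediately left of the leftmost column with its bottom box in the bottom row of $(\mathbf{w},n)$; $(r\mathbf{w},n)$ by adjoining a new row of $n$ boxes immediately below the bottom row with its leftmost box in the leftmost column. $\mathrm{BSD}(\mathbf{w},n)$ is the set of partitions of the boxes of $(\mathbf{w},n)$ into border strips of exactly $n$ boxes. The diagonals of $(\mathbf{w},n)$ are numbered starting at the top-right corner: the diagonal containing the top-right box (maximal content) is numbered $n+k$, the diagonal of the next lower content $n+k-1$, and so on down to $1$ (diagonals of lower content are unnumbered). -}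

module Defs where

open import Data.Nat as ℕ using (ℕ; zero; suc)
open import Data.Integer as ℤ using (ℤ; +_; _+_; _-_; _≤_)
open import Data.Product using (_×_; _,_; proj₁; proj₂; ∃; ∃-syntax; Σ-syntax)
open import Data.Sum using (_⊎_)
open import Data.List using (List; []; _∷_; _++_; map; concatMap; concat; length)
open import Data.List.Membership.Propositional using (_∈_)
open import Data.List.Relation.Unary.Unique.Propositional using (Unique)
open import Data.List.Relation.Binary.Permutation.Propositional using (_↭_)
open import Data.Empty using (⊥)
open import Relation.Binary.PropositionalEquality using (_≡_)
open import Function.Bundles using (_⇔_)

data Letter : Set where
  r c : Letter

-- Boxes: (row , column), English convention (rows grow downwards,
-- columns grow to the right).  Content of box (i , j) is j - i.

Box : Set
Box = ℤ × ℤ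

row col content : Box → ℤ
row = proj₁
col = proj₂
content (i , j) = j - i

range : ℤ → ℕ → List ℤ
range a zero    = []
range a (suc m) = a ∷ range (a + + 1) m

-- Simple diagrams (w , n).  The initial n×n square occupies rows
-- 0..n-1 and columns 0..n-1.  We track the leftmost column and the
-- bottom row of (w , n).

leftCol : ℕ → List Letter → ℤ
leftCol n []      = + 0
leftCol n (c ∷ w) = leftCol n w - + 1
leftCol n (r ∷ w) = leftCol n w

bottomRow : ℕ → List Letter → ℤ
bottomRow n []      = + n - + 1
bottomRow n (c ∷ w) = bottomRow n w
bottomRow n (r ∷ w) = bottomRow n w + + 1

diagram : ℕ → List Letter → List Box
diagram n [] = concatMap (λ i → map (λ j → (i , j)) (range (+ 0) n)) (range (+ 0) n)
diagram n (c ∷ w) =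
  map (λ i → (i , leftCol n w - + 1)) (range (bottomRow n w - + n + + 1) n)
  ++ diagram n w
diagram n (r ∷ w) =
  map (λ j → (bottomRow n w + + 1 , j)) (range (leftCol n w) n)
  ++ diagram n w

Adjacent : Box → Box → Set
Adjacent (i , j) (i' , j') =
  (i' ≡ i × (j' ≡ j + + 1 ⊎ j ≡ j' + + 1)) ⊎
  (j' ≡ j × (i' ≡ i + + 1 ⊎ i ≡ i' + + 1))

data Reach (S : List Box) : Box → Box → Set where
  here : ∀ {a} → a ∈ S → Reach S a a
  step : ∀ {a b b'} → Reach S a b → b' ∈ S → Adjacent b b' → Reach S a b'

Connected : List Box → Set
Connected S = ∀ {a b} → a ∈ S → b ∈ S → Reach S a b

-- skew shape: convex for the product order on (row , column)
IsSkewShape : List Box → Set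
IsSkewShape S = ∀ {a b x} → a ∈ S → b ∈ S →
  row a ≤ row x → row x ≤ row b → col a ≤ col x → col x ≤ col b → x ∈ S

No2x2 : List Box → Set
No2x2 S = ∀ i j → (i , j) ∈ S → (i , j + + 1) ∈ S →
  (i + + 1 , j) ∈ S → (i + + 1 , j + + 1) ∈ S → ⊥

IsBorderStrip : List Box → Set
IsBorderStrip S = Unique S × Connected S × IsSkewShape S × No2x2 S

IsHead : List Box → Box → Set
IsHead S h = h ∈ S × (∀ {b} → b ∈ S → content b ≤ content h)

-- BSD(w , n): partitions of the boxes of (w , n) into border strips of
-- exactly n boxes.  A decomposition is a list of strips whose
-- concatenation is a rearrangement of the boxes of the diagram.

IsBSD : List Letter → ℕ → List (List Box) → Set
IsBSD w n D =
  (∀ {S} → S ∈ D → IsBorderStrip S × length S ≡ n) ×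
  (concat D ↭ diagram n w)

-- Diagonal numbering: the diagonal of the top-right box (content n-1)
-- is numbered n+k; numbering decreases by one with content.

diagContent : ℕ → ℕ → ℕ → ℤ
diagContent n k d = (+ n - + 1) - (+ (n ℕ.+ k) - + d)

HeadOnDiag : ℕ → ℕ → ℕ → List Box → Set
HeadOnDiag n k d S = ∃[ h ] (IsHead S h × content h ≡ diagContent n k d)

SameHeads : List (List Box) → List (List Box) → Set
SameHeads D D' = ∀ h →
  (∃[ S ] (S ∈ D × IsHead S h)) ⇔ (∃[ S ] (S ∈ D' × IsHead S h))

SameStrip : List (List Box) → Box → Box → Set
SameStrip D a b = ∃[ S ] (S ∈ D × a ∈ S × b ∈ S)

SamePartition : List (List Box) → List (List Box) → Set
SamePartition D D' = ∀ a b → SameStrip D a b ⇔ SameStrip D' a b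

module Submission where

-- Part 1 is a counting argument.  A border strip of n boxes meets every
-- diagonal at most once (it has no 2×2 square) and, being connected, its
-- contents are the n consecutive integers ending at its head content.
-- Counting the boxes of content t strip by strip therefore gives
--   #{boxes of (w , n) of content t} = Σ_{i<n} #{strips of D with head content t+i}.
-- From the recursive shape of (w , n) the left-hand side is
-- Σ_{i<n} numberedDiagonal(t+i), numberedDiagonal being the indicator of the
-- contents -k, …, n-1 of the numbered diagonals.  Two functions vanishing
-- above n-1 with equal sums over all windows of n consecutive integers are
-- equal, so each numbered diagonal carries exactly one head.
--
-- Part 2 compares decompositions D, D' with the same heads: by induction on
-- (n-1 - content, row), every box lies in strips of D and D' with the same
-- head content.  Away from the heads both strips continue from a box x to
-- the box above or to the right of x, and a mismatch contradicts the
-- induction hypothesis.  As head contents identify strips (Part 1), D and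
-- D' are the same partition.

open import Defs
open import Data.Nat as ℕ using (ℕ; zero; suc)
import Data.Nat.Properties as ℕP
open import Data.Nat.ListAction using (sum)
import Data.Nat.ListAction.Properties as ℕLP
open import Data.Integer as ℤ using (ℤ; +_; _+_; _-_; -_; _≤_; _<_; ∣_∣)
import Data.Integer.Properties as ℤP
open import Data.Integer.Tactic.RingSolver using (solve-∀)
import Data.Nat.Tactic.RingSolver as ℕSolver
open import Data.Fin using (Fin)
import Data.Fin as Fin
open import Data.Product using (∃; ∃-syntax; _×_; _,_; proj₁; proj₂)
open import Data.Sum using (_⊎_; inj₁; inj₂)
open import Data.Empty using (⊥; ⊥-elim)
open import Relation.Nullary using (¬_; Dec; yes; no)
open import Relation.Binary.PropositionalEquality
open import Relation.Binary.Definitions using (tri<; tri≈; tri>)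
open import Function.Bundles using (mk⇔; Equivalence)
open import Data.Nat.Induction using (<-rec)
open import Data.List using (List; []; _∷_; _++_; length; map; concat; lookup)
import Data.List.Properties as ListP
open import Data.List.Membership.Propositional using (_∈_)
open import Data.List.Membership.Propositional.Properties
  using (∈-map⁺; ∈-map⁻; ∈-∃++; ∈-++⁻; ∈-++⁺ˡ; ∈-++⁺ʳ; ∈-concat⁺′; ∈-concat⁻′; ∈-lookup)
open import Data.List.Relation.Unary.Any using (here; there)
open import Data.List.Relation.Unary.All as All using ([]; _∷_)
import Data.List.Relation.Unary.All.Properties as AllP
open import Data.List.Relation.Unary.AllPairs as AllPairs using ([]; _∷_)
import Data.List.Relation.Unary.AllPairs.Properties as AllPairsP
open import Data.List.Relation.Unary.Unique.Propositional using (Unique)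
import Data.List.Relation.Unary.Unique.Propositional.Properties as UniqueP
open import Data.List.Relation.Binary.Disjoint.Propositional using (Disjoint)
open import Data.List.Relation.Binary.Permutation.Propositional using (_↭_; ↭-sym; ↭⇒↭ₛ)
import Data.List.Relation.Binary.Permutation.Propositional.Properties as PermP
import Data.List.Relation.Binary.Permutation.Setoid.Properties as PermSetoidP

≤-witness : ∀ {a b} → a ≤ b → ∃ λ p → b ≡ a + + p
≤-witness {a} {b} a≤b =
  ∣ b - a ∣ , trans (split a b) (cong (λ z → a + z) (sym (ℤP.0≤i⇒+∣i∣≡i (ℤP.i≤j⇒0≤j-i a≤b))))
  where
  split : ∀ a b → b ≡ a + (b - a)
  split = solve-∀

witness⇒≤ : ∀ {a b} p → b ≡ a + + p → a ≤ b
witness⇒≤ {a} p refl = ℤP.i≤i+j a (+ p)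

≤-+ : ∀ a p → a ≤ a + + p
≤-+ a p = witness⇒≤ p refl

<-witness : ∀ {a b} → a < b → ∃ λ p → b ≡ a + + 1 + + p
<-witness {a} a<b with ≤-witness (ℤP.i<j⇒suc[i]≤j a<b)
... | p , eq = p , trans eq (reassoc a (+ p))
  where
  reassoc : ∀ a q → + 1 + a + q ≡ a + + 1 + q
  reassoc = solve-∀

witness⇒< : ∀ {a b} p → b ≡ a + + 1 + + p → a < b
witness⇒< {a} p eq = ℤP.suc[i]≤j⇒i<j (witness⇒≤ p (trans eq (reassoc a (+ p))))
  where
  reassoc : ∀ a q → a + + 1 + q ≡ + 1 + a + q
  reassoc = solve-∀

<-+1 : ∀ a → a < a + + 1
<-+1 a = witness⇒< 0 (sym (ℤP.+-identityʳ _))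

≤-≡ : ∀ {a b c} → a ≤ b → b ≡ c → a ≤ c
≤-≡ le refl = le

≡-≤ : ∀ {a b c} → a ≡ b → b ≤ c → a ≤ c
≡-≤ refl le = le

+-cancelˡ : ∀ t {x y} → t + x ≡ t + y → x ≡ y
+-cancelˡ t {x} {y} e = trans (unshift t x) (trans (cong (λ z → - t + z) e) (sym (unshift t y)))
  where
  unshift : ∀ t x → x ≡ - t + (t + x)
  unshift = solve-∀

+-cancelˡ-≤ : ∀ t {x y} → t + x ≤ t + y → x ≤ y
+-cancelˡ-≤ t {x} {y} le = ≡-≤ (unshift t x) (≤-≡ (ℤP.+-monoʳ-≤ (- t) le) (sym (unshift t y)))
  where
  unshift : ∀ t x → x ≡ - t + (t + x)
  unshift = solve-∀

translate-injective : ∀ t i j → t + + i ≡ t + + j → i ≡ j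
translate-injective t i j e = ℤP.+-injective (+-cancelˡ t e)

+1-+ : ∀ a p → a + + suc p ≡ a + + 1 + + p
+1-+ a p = trans (cong (λ z → a + z) (ℤP.pos-+ 1 p)) (sym (ℤP.+-assoc a (+ 1) (+ p)))

Σ< : ℕ → (ℕ → ℕ) → ℕ
Σ< zero    f = 0
Σ< (suc n) f = f 0 ℕ.+ Σ< n (λ i → f (suc i))

Σ<-cong : ∀ n {f g} → (∀ i → f i ≡ g i) → Σ< n f ≡ Σ< n g
Σ<-cong zero    e = refl
Σ<-cong (suc n) e = cong₂ ℕ._+_ (e 0) (Σ<-cong n (λ i → e (suc i)))

Σ<-+ : ∀ n f g → Σ< n (λ i → f i ℕ.+ g i) ≡ Σ< n f ℕ.+ Σ< n g
Σ<-+ zero    f g = refl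
Σ<-+ (suc n) f g rewrite Σ<-+ n (λ i → f (suc i)) (λ i → g (suc i)) =
  interchange (f 0) (g 0) (Σ< n (λ i → f (suc i))) (Σ< n (λ i → g (suc i)))
  where
  interchange : ∀ a b c d → a ℕ.+ b ℕ.+ (c ℕ.+ d) ≡ a ℕ.+ c ℕ.+ (b ℕ.+ d)
  interchange = ℕSolver.solve-∀

Σ<-last : ∀ n f → Σ< (suc n) f ≡ Σ< n f ℕ.+ f n
Σ<-last zero    f = ℕP.+-comm (f 0) 0
Σ<-last (suc n) f rewrite Σ<-last n (λ i → f (suc i)) = sym (ℕP.+-assoc (f 0) _ _)

Σ<-zero : ∀ n → Σ< n (λ _ → 0) ≡ 0
Σ<-zero zero    = refl
Σ<-zero (suc n) = Σ<-zero n

ΣL : ∀ {A : Set} → (A → ℕ) → List A → ℕ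
ΣL f xs = sum (map f xs)

ΣL-++ : ∀ {A : Set} (f : A → ℕ) xs ys → ΣL f (xs ++ ys) ≡ ΣL f xs ℕ.+ ΣL f ys
ΣL-++ f xs ys = trans (cong sum (ListP.map-++ f xs ys)) (ℕLP.sum-++ (map f xs) (map f ys))

ΣL-concat : ∀ {A : Set} (f : A → ℕ) xss → ΣL f (concat xss) ≡ ΣL (ΣL f) xss
ΣL-concat f []         = refl
ΣL-concat f (xs ∷ xss) = trans (ΣL-++ f xs (concat xss)) (cong (ΣL f xs ℕ.+_) (ΣL-concat f xss))

ΣL-↭ : ∀ {A : Set} (f : A → ℕ) {xs ys} → xs ↭ ys → ΣL f xs ≡ ΣL f ys
ΣL-↭ f p = ℕLP.sum-↭ (PermP.map⁺ f p)

ΣL-map : ∀ {A B : Set} (g : B → ℕ) (f : A → B) xs → ΣL g (map f xs) ≡ ΣL (λ x → g (f x)) xs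
ΣL-map g f xs = cong sum (sym (ListP.map-∘ xs))

ΣL-cong : ∀ {A : Set} {f g : A → ℕ} xs → (∀ {x} → x ∈ xs → f x ≡ g x) → ΣL f xs ≡ ΣL g xs
ΣL-cong []       e = refl
ΣL-cong (x ∷ xs) e = cong₂ ℕ._+_ (e (here refl)) (ΣL-cong xs (λ m → e (there m)))

ΣL-Σ< : ∀ {A : Set} n (g : A → ℕ → ℕ) xs →
  ΣL (λ x → Σ< n (g x)) xs ≡ Σ< n (λ i → ΣL (λ x → g x i) xs)
ΣL-Σ< n g []       = sym (Σ<-zero n)
ΣL-Σ< n g (x ∷ xs) rewrite ΣL-Σ< n g xs = sym (Σ<-+ n (g x) (λ i → ΣL (λ x → g x i) xs))

δ : ∀ {P : Set} → Dec P → ℕ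
δ (yes _) = 1
δ (no _)  = 0

δ-cong : ∀ {P Q : Set} → (P → Q) → (Q → P) → (p : Dec P) (q : Dec Q) → δ p ≡ δ q
δ-cong f g (yes p) (yes q) = refl
δ-cong f g (yes p) (no ¬q) = ⊥-elim (¬q (f p))
δ-cong f g (no ¬p) (yes q) = ⊥-elim (¬p (g q))
δ-cong f g (no ¬p) (no ¬q) = refl

δ-sym : ∀ (a b : ℤ) → δ (a ℤ.≟ b) ≡ δ (b ℤ.≟ a)
δ-sym a b = δ-cong sym sym (a ℤ.≟ b) (b ℤ.≟ a)

hits : ℕ → (ℕ → ℤ) → ℤ → ℕ
hits n g u = Σ< n (λ i → δ (g i ℤ.≟ u))

bounded∃? : ∀ n (P : ℕ → Set) → (∀ i → Dec (P i)) → Dec (∃ λ i → i ℕ.< n × P i)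
bounded∃? zero    P P? = no (λ { (i , () , _) })
bounded∃? (suc n) P P? with P? 0
... | yes p = yes (0 , ℕ.s≤s ℕ.z≤n , p)
... | no ¬p with bounded∃? n (λ i → P (suc i)) (λ i → P? (suc i))
...   | yes (i , i<n , p) = yes (suc i , ℕ.s≤s i<n , p)
...   | no ¬q = no λ { (zero , _ , p) → ¬p p ; (suc i , ℕ.s≤s i<n , p) → ¬q (i , i<n , p) }

hits-absent : ∀ n g u → (∀ i → i ℕ.< n → g i ≢ u) → hits n g u ≡ 0
hits-absent zero    g u miss = refl
hits-absent (suc n) g u miss with g 0 ℤ.≟ u
... | yes e = ⊥-elim (miss 0 (ℕ.s≤s ℕ.z≤n) e)
... | no _  = hits-absent n (λ i → g (suc i)) u (λ i i<n → miss (suc i) (ℕ.s≤s i<n))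

hits-once : ∀ n g u → (∀ i j → g i ≡ g j → i ≡ j) → ∀ i → i ℕ.< n → g i ≡ u → hits n g u ≡ 1
hits-once (suc n) g u inj zero _ e with g 0 ℤ.≟ u
... | yes _ = cong suc (hits-absent n (λ i → g (suc i)) u
                (λ j _ e' → ℕP.0≢1+n (sym (inj _ _ (trans e' (sym e))))))
... | no ne = ⊥-elim (ne e)
hits-once (suc n) g u inj (suc i) (ℕ.s≤s i<n) e with g 0 ℤ.≟ u
... | yes e0 = ⊥-elim (ℕP.0≢1+n (inj _ _ (trans e0 (sym e))))
... | no _   = hits-once n (λ i → g (suc i)) u (λ a b x → ℕP.suc-injective (inj _ _ x)) i i<n e

hits≤1 : ∀ n g u → (∀ i j → g i ≡ g j → i ≡ j) → hits n g u ℕ.≤ 1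
hits≤1 n g u inj with bounded∃? n (λ i → g i ≡ u) (λ i → g i ℤ.≟ u)
... | yes (i , i<n , e) = ℕP.≤-reflexive (hits-once n g u inj i i<n e)
... | no ∄ = subst (ℕ._≤ 1) (sym (hits-absent n g u (λ i i<n e → ∄ (i , i<n , e)))) ℕ.z≤n

hits-cong : ∀ n m g g' u u' →
  (∀ i j → g i ≡ g j → i ≡ j) → (∀ i j → g' i ≡ g' j → i ≡ j) →
  ((∃ λ i → i ℕ.< n × g i ≡ u) → (∃ λ i → i ℕ.< m × g' i ≡ u')) →
  ((∃ λ i → i ℕ.< m × g' i ≡ u') → (∃ λ i → i ℕ.< n × g i ≡ u)) →
  hits n g u ≡ hits m g' u'
hits-cong n m g g' u u' inj inj' to from with bounded∃? n (λ i → g i ≡ u) (λ i → g i ℤ.≟ u)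
... | yes (i , i<n , e) with to (i , i<n , e)
...   | (i' , i'<m , e') = trans (hits-once n g u inj i i<n e) (sym (hits-once m g' u' inj' i' i'<m e'))
hits-cong n m g g' u u' inj inj' to from | no ∄ =
  trans (hits-absent n g u (λ i i<n e → ∄ (i , i<n , e)))
        (sym (hits-absent m g' u' (λ i i<m e → ∄ (from (i , i<m , e)))))

-- Two functions ℤ → ℕ that vanish above U and have equal
-- sums over every window of m+1 consecutive integers are equal: descending
-- from U, each value is the difference of two window sums.

module WindowSums (m : ℕ) (a b : ℤ → ℕ) (U : ℤ)
  (a-vanishes : ∀ u → U < u → a u ≡ 0) (b-vanishes : ∀ u → U < u → b u ≡ 0)
  (windows : ∀ t → Σ< (suc m) (λ i → a (t + + i)) ≡ Σ< (suc m) (λ i → b (t + + i))) where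

  private
    tail-window : ∀ (f : ℤ → ℕ) t →
      Σ< m (λ i → f (t + + suc i)) ≡ Σ< m (λ i → f ((t + + 1) + + i))
    tail-window f t = Σ<-cong m (λ i → cong f (+1-+ t i))

  -- a and b agree at t as soon as they agree at the end t+m+1 of the
  -- next window: comparing the windows at t and t+1.
  agree-step : ∀ t → a (t + + suc m) ≡ b (t + + suc m) → a t ≡ b t
  agree-step t agree-end =
    subst (λ z → a z ≡ b z) (ℤP.+-identityʳ t) (ℕP.+-cancelʳ-≡ A (a (t + + 0)) (b (t + + 0)) head-eq)
    where
    A B : ℕ
    A = Σ< m (λ i → a ((t + + 1) + + i))
    B = Σ< m (λ i → b ((t + + 1) + + i))
    next-window : A ℕ.+ a ((t + + 1) + + m) ≡ B ℕ.+ b ((t + + 1) + + m)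
    next-window = trans (sym (Σ<-last m (λ i → a ((t + + 1) + + i))))
                    (trans (windows (t + + 1)) (Σ<-last m (λ i → b ((t + + 1) + + i))))
    A≡B : A ≡ B
    A≡B = ℕP.+-cancelʳ-≡ (a ((t + + 1) + + m)) A B
            (trans next-window (cong (B ℕ.+_) (sym (subst (λ z → a z ≡ b z) (+1-+ t m) agree-end))))
    head-eq : a (t + + 0) ℕ.+ A ≡ b (t + + 0) ℕ.+ A
    head-eq = trans (cong (a (t + + 0) ℕ.+_) (sym (tail-window a t)))
                (trans (windows t) (cong (b (t + + 0) ℕ.+_) (trans (tail-window b t) (sym A≡B))))

  private
    agree-below : ∀ F N → N ℕ.< F → a (U - + N) ≡ b (U - + N)
    agree-below (suc F) N (ℕ.s≤s N≤F) with suc m ℕ.≤? N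
    ... | yes m<N = agree-step (U - + N) (subst (λ z → a z ≡ b z) (sym end≡) (agree-below F M M<F))
      where
      M : ℕ
      M = N ℕ.∸ suc m
      N≡ : N ≡ suc m ℕ.+ M
      N≡ = sym (ℕP.m+[n∸m]≡n m<N)
      end≡ : U - + N + + suc m ≡ U - + M
      end≡ = trans (cong (λ z → U - + z + + suc m) N≡)
               (trans (cong (λ z → U - z + + suc m) (ℤP.pos-+ (suc m) M)) (cancel U (+ suc m) (+ M)))
        where
        cancel : ∀ U x y → U - (x + y) + x ≡ U - y
        cancel = solve-∀
      M<F : M ℕ.< F
      M<F = ℕP.<-≤-trans (subst (M ℕ.<_) (sym N≡) (ℕP.m<n+m M (ℕ.s≤s ℕ.z≤n))) N≤F
    ... | no N≤m = agree-step (U - + N) (trans (a-vanishes _ above) (sym (b-vanishes _ above)))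
      where
      K : ℕ
      K = suc m ℕ.∸ suc N
      m≡ : suc m ≡ suc N ℕ.+ K
      m≡ = sym (ℕP.m+[n∸m]≡n (ℕP.≰⇒> N≤m))
      above : U < U - + N + + suc m
      above = witness⇒< K (trans (cong (λ z → U - + N + + z) m≡)
                (trans (cong (λ z → U - + N + z) (ℤP.pos-+ (suc N) K))
                  (trans (cong (λ z → U - + N + (z + + K)) (ℤP.pos-+ 1 N)) (cancel U (+ N) (+ K)))))
        where
        cancel : ∀ U x y → U - x + (+ 1 + x + y) ≡ U + + 1 + y
        cancel = solve-∀

  agree : ∀ u → a u ≡ b u
  agree u with u ℤ.≤? U
  ... | no u≰U = trans (a-vanishes u (ℤP.≰⇒> u≰U)) (sym (b-vanishes u (ℤP.≰⇒> u≰U)))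
  ... | yes u≤U with ≤-witness u≤U
  ...   | N , eq = subst (λ z → a z ≡ b z) (sym u≡) (agree-below (suc N) N (ℕP.n<1+n N))
    where
    u≡ : u ≡ U - + N
    u≡ = trans (cancel u (+ N)) (cong (λ z → z - + N) (sym eq))
      where
      cancel : ∀ u x → u ≡ u + x - x
      cancel = solve-∀

up right : Box → Box
up    (i , j) = (i - + 1 , j)
right (i , j) = (i , j + + 1)

content-up : ∀ x → content (up x) ≡ content x + + 1
content-up (i , j) = shift i j
  where
  shift : ∀ i j → j - (i - + 1) ≡ j - i + + 1
  shift = solve-∀

content-right : ∀ x → content (right x) ≡ content x + + 1
content-right (i , j) = shift i j
  where
  shift : ∀ i j → j + + 1 - i ≡ j - i + + 1
  shift = solve-∀

up≢right : ∀ x → up x ≢ right x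
up≢right (i , j) e = ℤP.<-irrefl (cong proj₁ e) (subst (i - + 1 <_) (cancel i) (<-+1 (i - + 1)))
  where
  cancel : ∀ i → i - + 1 + + 1 ≡ i
  cancel = solve-∀

-- In a skew shape without 2×2 squares two boxes on one diagonal are equal:
-- otherwise the skew shape would contain the 2×2 square at the upper one.
private
  two-on-diagonal : ∀ {S} → IsSkewShape S → No2x2 S → ∀ {i j i' j'} → (i , j) ∈ S → (i' , j') ∈ S →
    j - i ≡ j' - i' → i < i' → ⊥
  two-on-diagonal {S} skew no2x2 {i} {j} {i'} {j'} x∈ y∈ same i<i' with <-witness i<i'
  ... | p , i'≡ = no2x2 i j x∈ b01 b10 b11
    where
    j'≡ : j' ≡ j + + 1 + + p
    j'≡ = trans (unshift j' i') (trans (cong (λ z → z + i') (sym same))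
            (trans (cong (λ z → j - i + z) i'≡) (shift j i (+ p))))
      where
      unshift : ∀ a b → a ≡ a - b + b
      unshift = solve-∀
      shift : ∀ j i q → j - i + (i + + 1 + q) ≡ j + + 1 + q
      shift = solve-∀
    b01 : (i , j + + 1) ∈ S
    b01 = skew x∈ y∈ ℤP.≤-refl (witness⇒≤ _ (trans i'≡ (ℤP.+-assoc i (+ 1) (+ p)))) (≤-+ j 1) (witness⇒≤ p j'≡)
    b10 : (i + + 1 , j) ∈ S
    b10 = skew x∈ y∈ (≤-+ i 1) (witness⇒≤ p i'≡) ℤP.≤-refl (witness⇒≤ _ (trans j'≡ (ℤP.+-assoc j (+ 1) (+ p))))
    b11 : (i + + 1 , j + + 1) ∈ S
    b11 = skew x∈ y∈ (≤-+ i 1) (witness⇒≤ p i'≡) (≤-+ j 1) (witness⇒≤ p j'≡)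

content-injective : ∀ {S} → IsSkewShape S → No2x2 S →
  ∀ {x y} → x ∈ S → y ∈ S → content x ≡ content y → x ≡ y
content-injective skew no2x2 {i , j} {i' , j'} x∈ y∈ same with ℤP.<-cmp i i'
... | tri< lt _ _ = ⊥-elim (two-on-diagonal skew no2x2 x∈ y∈ same lt)
... | tri> _ _ gt = ⊥-elim (two-on-diagonal skew no2x2 y∈ x∈ (sym same) gt)
... | tri≈ _ refl _ = cong (i ,_) (trans (unshift j i) (trans (cong (λ z → z + i) same) (sym (unshift j' i))))
  where
  unshift : ∀ a b → a ≡ a - b + b
  unshift = solve-∀

adjacent-content : ∀ {b b'} → Adjacent b b' →
  content b' ≡ content b + + 1 ⊎ content b ≡ content b' + + 1
adjacent-content {b} (inj₁ (refl , inj₁ refl)) = inj₁ (content-right b)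
adjacent-content {_} {b'} (inj₁ (refl , inj₂ refl)) = inj₂ (content-right b')
adjacent-content {i , j} (inj₂ (refl , inj₁ refl)) = inj₂ (shift j i)
  where
  shift : ∀ j i → j - i ≡ j - (i + + 1) + + 1
  shift = solve-∀
adjacent-content {i , j} {i' , _} (inj₂ (refl , inj₂ refl)) = inj₁ (shift j i')
  where
  shift : ∀ j i → j - i ≡ j - (i + + 1) + + 1
  shift = solve-∀

-- A connected set meets every diagonal between two of its boxes
-- (discrete intermediate value theorem along a path).
content-interval : ∀ {S} → Connected S → ∀ {x y} → x ∈ S → y ∈ S → ∀ t →
  content x ≤ t → t ≤ content y → ∃ λ z → z ∈ S × content z ≡ t
content-interval {S} connected {x} x∈ y∈ = along (connected x∈ y∈)
  where
  along : ∀ {b} → Reach S x b → ∀ t → content x ≤ t → t ≤ content b → ∃ λ z → z ∈ S × content z ≡ t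
  along (here x∈S) t x≤t t≤x = x , x∈S , ℤP.≤-antisym x≤t t≤x
  along (step {b = b} {b' = b'} path b'∈ adj) t x≤t t≤b' with t ℤ.≤? content b
  ... | yes t≤b = along path t x≤t t≤b
  ... | no t≰b with adjacent-content adj | <-witness (ℤP.≰⇒> t≰b)
  ...   | inj₁ b'≡ | p , t≡ =
          b' , b'∈ , ℤP.≤-antisym (≤-≡ (≤-+ _ p) (trans (cong (λ z → z + + p) b'≡) (sym t≡))) t≤b'
  ...   | inj₂ b≡ | p , t≡ =
          ⊥-elim (ℤP.<-irrefl refl (ℤP.<-≤-trans (ℤP.<-trans b'<b (witness⇒< p t≡)) t≤b'))
    where
    b'<b : content b' < content b
    b'<b = witness⇒< 0 (trans b≡ (sym (ℤP.+-identityʳ _)))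

-- In a skew shape without 2×2 squares, a box z on the diagonal after x is
-- the box above x if z lies in a higher row, and otherwise the box to the
-- right of x: in each case that box lies between x and z.
private
  successor-above : ∀ {S} → IsSkewShape S → No2x2 S → ∀ {i j i' j'} → (i , j) ∈ S → (i' , j') ∈ S →
    content (i' , j') ≡ content (i , j) + + 1 → i' < i → (i' , j') ≡ up (i , j)
  successor-above {S} skew no2x2 {i} {j} {i'} {j'} x∈ z∈ next i'<i with <-witness i'<i
  ... | p , i≡ = content-injective skew no2x2 z∈ up∈ (trans next (sym (content-up (i , j))))
    where
    j'≡ : j' ≡ j - (i' + + 1 + + p) + + 1 + i'
    j'≡ = trans (unshift j' i') (trans (cong (λ z → z + i') next) (cong (λ z → j - z + + 1 + i') i≡))
      where
      unshift : ∀ a b → a ≡ a - b + b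
      unshift = solve-∀
    j≡ : j ≡ j' + + p
    j≡ = sym (trans (cong (λ z → z + + p) j'≡) (cancel j i' (+ p)))
      where
      cancel : ∀ j i p → j - (i + + 1 + p) + + 1 + i + p ≡ j
      cancel = solve-∀
    i-1≡ : i - + 1 ≡ i' + + p
    i-1≡ = trans (cong (λ z → z - + 1) i≡) (cancel i' (+ p))
      where
      cancel : ∀ i p → i + + 1 + p - + 1 ≡ i + p
      cancel = solve-∀
    up∈ : (i - + 1 , j) ∈ S
    up∈ = skew z∈ x∈ (witness⇒≤ p i-1≡) (witness⇒≤ 1 (cancel i)) (witness⇒≤ p j≡) ℤP.≤-refl
      where
      cancel : ∀ i → i ≡ i - + 1 + + 1
      cancel = solve-∀

  successor-not-above : ∀ {S} → IsSkewShape S → No2x2 S → ∀ {i j i' j'} → (i , j) ∈ S → (i' , j') ∈ S →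
    content (i' , j') ≡ content (i , j) + + 1 → i ≤ i' → (i' , j') ≡ right (i , j)
  successor-not-above {S} skew no2x2 {i} {j} {i'} {j'} x∈ z∈ next i≤i' with ≤-witness i≤i'
  ... | q , i'≡ = content-injective skew no2x2 z∈ right∈ (trans next (sym (content-right (i , j))))
    where
    j'≡ : j' ≡ j + + 1 + + q
    j'≡ = trans (unshift j' i') (trans (cong (λ z → z + i') next)
            (trans (cong (λ z → j - i + + 1 + z) i'≡) (shift j i (+ q))))
      where
      unshift : ∀ a b → a ≡ a - b + b
      unshift = solve-∀
      shift : ∀ j i q → j - i + + 1 + (i + q) ≡ j + + 1 + q
      shift = solve-∀
    right∈ : (i , j + + 1) ∈ S
    right∈ = skew x∈ z∈ ℤP.≤-refl (witness⇒≤ q i'≡) (≤-+ j 1) (witness⇒≤ q j'≡)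

successor-up-or-right : ∀ {S} → IsSkewShape S → No2x2 S → ∀ {x z} → x ∈ S → z ∈ S →
  content z ≡ content x + + 1 → z ≡ up x ⊎ z ≡ right x
successor-up-or-right skew no2x2 {i , j} {i' , j'} x∈ z∈ next with i' ℤ.<? i
... | yes i'<i = inj₁ (successor-above skew no2x2 x∈ z∈ next i'<i)
... | no i'≮i  = inj₂ (successor-not-above skew no2x2 x∈ z∈ next (ℤP.≮⇒≥ i'≮i))

-- The head content of a list of boxes: its maximal content (0 if empty).
-- A head of S is exactly a box of S of content maxContent S.

maxContent : List Box → ℤ
maxContent []           = + 0
maxContent (x ∷ [])     = content x
maxContent (x ∷ y ∷ xs) = content x ℤ.⊔ maxContent (y ∷ xs)

maxContent-bound : ∀ {b} S → b ∈ S → content b ≤ maxContent S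
maxContent-bound (x ∷ [])     (here refl) = ℤP.≤-refl
maxContent-bound (x ∷ y ∷ xs) (here refl) = ℤP.i≤i⊔j _ _
maxContent-bound (x ∷ y ∷ xs) (there b∈)  = ℤP.≤-trans (maxContent-bound (y ∷ xs) b∈) (ℤP.i≤j⊔i (content x) _)

maxContent-attained : ∀ {b} S → b ∈ S → ∃ λ h → h ∈ S × content h ≡ maxContent S
maxContent-attained (x ∷ xs) _ = attained x xs
  where
  attained : ∀ x xs → ∃ λ h → h ∈ x ∷ xs × content h ≡ maxContent (x ∷ xs)
  attained x []       = x , here refl , refl
  attained x (y ∷ xs) with ℤP.⊔-sel (content x) (maxContent (y ∷ xs))
  ... | inj₁ e = x , here refl , sym e
  ... | inj₂ e with attained y xs
  ...   | h , h∈ , h≡ = h , there h∈ , trans h≡ (sym e)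

head⇒maxContent : ∀ {S h} → IsHead S h → content h ≡ maxContent S
head⇒maxContent {S} (h∈ , top) with maxContent-attained S h∈
... | h' , h'∈ , h'≡ = ℤP.≤-antisym (maxContent-bound S h∈) (≡-≤ (sym h'≡) (top h'∈))

maxContent⇒head : ∀ {S h} → h ∈ S → content h ≡ maxContent S → IsHead S h
maxContent⇒head {S} h∈ h≡ = h∈ , λ b∈ → ≤-≡ (maxContent-bound S b∈) (sym h≡)

∈-range⁻ : ∀ {x} a N → x ∈ range a N → ∃ λ p → p ℕ.< N × x ≡ a + + p
∈-range⁻ a (suc N) (here refl) = 0 , ℕ.s≤s ℕ.z≤n , sym (ℤP.+-identityʳ a)
∈-range⁻ a (suc N) (there x∈) with ∈-range⁻ (a + + 1) N x∈
... | p , p<N , x≡ = suc p , ℕ.s≤s p<N , trans x≡ (sym (+1-+ a p))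

∈-range⁺ : ∀ a N p → p ℕ.< N → a + + p ∈ range a N
∈-range⁺ a (suc N) zero    _           = here (ℤP.+-identityʳ a)
∈-range⁺ a (suc N) (suc p) (ℕ.s≤s p<N) =
  there (subst (_∈ range (a + + 1) N) (sym (+1-+ a p)) (∈-range⁺ (a + + 1) N p p<N))

∈-map-range⁻ : ∀ {A : Set} {x : A} (f : ℤ → A) a N → x ∈ map f (range a N) →
  ∃ λ p → p ℕ.< N × x ≡ f (a + + p)
∈-map-range⁻ f a N x∈ with ∈-map⁻ f x∈
... | y , y∈ , refl with ∈-range⁻ a N y∈
...   | p , p<N , refl = p , p<N , refl

range-unique : ∀ a N → Unique (range a N)
range-unique a zero    = []
range-unique a (suc N) = All.tabulate a∉ ∷ range-unique (a + + 1) N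
  where
  a∉ : ∀ {y} → y ∈ range (a + + 1) N → a ≢ y
  a∉ y∈ refl with ∈-range⁻ (a + + 1) N y∈
  ... | p , _ , a≡ = ℤP.<-irrefl a≡ (witness⇒< p refl)

length-range : ∀ a N → length (range a N) ≡ N
length-range a zero    = refl
length-range a (suc N) = cong suc (length-range (a + + 1) N)

unique-⊆⇒length≤ : ∀ {A : Set} {ys xs : List A} → Unique ys → (∀ {z} → z ∈ ys → z ∈ xs) →
  length ys ℕ.≤ length xs
unique-⊆⇒length≤ {ys = []}          []          _   = ℕ.z≤n
unique-⊆⇒length≤ {ys = y ∷ ys} {xs} (y∉ ∷ uniq) sub with ∈-∃++ (sub (here refl))
... | as , bs , refl =
  ℕP.≤-trans (ℕ.s≤s (unique-⊆⇒length≤ uniq sub')) (ℕP.≤-reflexive (sym (ListP.length-++-sucʳ as y bs)))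
  where
  sub' : ∀ {z} → z ∈ ys → z ∈ as ++ bs
  sub' {z} z∈ with ∈-++⁻ as (sub (there z∈))
  ... | inj₁ z∈as          = ∈-++⁺ˡ z∈as
  ... | inj₂ (here refl)   = ⊥-elim (All.lookup y∉ z∈ refl)
  ... | inj₂ (there z∈bs) = ∈-++⁺ʳ as z∈bs

map-unique : ∀ {A B : Set} (f : A → B) {xs : List A} → Unique xs →
  (∀ {x y} → x ∈ xs → y ∈ xs → f x ≡ f y → x ≡ y) → Unique (map f xs)
map-unique f {[]}     []         inj = []
map-unique f {x ∷ xs} (x∉ ∷ uniq) inj =
  AllP.map⁺ (All.tabulate (λ y∈ fx≡fy → All.lookup x∉ y∈ (inj (here refl) (there y∈) fx≡fy))) ∷
  map-unique f uniq (λ x∈ y∈ → inj (there x∈) (there y∈))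

HasContent : List Box → ℤ → Set
HasContent S t = ∃ λ z → z ∈ S × content z ≡ t

hasContent? : ∀ S t → Dec (HasContent S t)
hasContent? []      t = no λ { (_ , () , _) }
hasContent? (x ∷ S) t with content x ℤ.≟ t
... | yes e = yes (x , here refl , e)
... | no ne with hasContent? S t
...   | yes (z , z∈ , e) = yes (z , there z∈ , e)
...   | no ∄ = no λ { (z , here refl , e) → ne e ; (z , there z∈ , e) → ∄ (z , z∈ , e) }

module StripContents {S : List Box} {n : ℕ} (strip : IsBorderStrip S) (len : length S ≡ n) where
  private
    uniq : Unique S
    uniq = proj₁ strip
    connected : Connected S
    connected = proj₁ (proj₂ strip)
    skew : IsSkewShape S
    skew = proj₁ (proj₂ (proj₂ strip))
    no2x2 : No2x2 S
    no2x2 = proj₂ (proj₂ (proj₂ strip))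

  -- A content t of S lies less than n below the head: otherwise the n+1
  -- contents t, …, t+N, all present by connectedness, exceed length S.
  content⇒near-head : ∀ {t} → HasContent S t → ∃ λ i → i ℕ.< n × t + + i ≡ maxContent S
  content⇒near-head {t} (z , z∈ , refl) with ≤-witness (maxContent-bound S z∈)
  ... | N , max≡ with N ℕ.<? n
  ...   | yes N<n = N , N<n , sym max≡
  ...   | no N≮n  = ⊥-elim (N≮n (ℕP.<-≤-trans (ℕ.s≤s ℕP.≤-refl) N+1≤n))
    where
    sub : ∀ {y} → y ∈ range t (suc N) → y ∈ map content S
    sub {y} y∈ with ∈-range⁻ t (suc N) y∈ | maxContent-attained S z∈
    ... | p , p<N+1 , refl | h , h∈ , h≡
      with content-interval connected z∈ h∈ (t + + p) (≤-+ t p)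
             (≤-≡ (ℤP.+-monoʳ-≤ t (ℤ.+≤+ (ℕP.≤-pred p<N+1))) (trans (sym max≡) (sym h≡)))
    ...   | v , v∈ , v≡ = subst (_∈ map content S) v≡ (∈-map⁺ content v∈)
    N+1≤n : suc N ℕ.≤ n
    N+1≤n = subst (suc N ℕ.≤_) (trans (ListP.length-map content S) len)
              (subst (ℕ._≤ length (map content S)) (length-range t (suc N))
                (unique-⊆⇒length≤ (range-unique t (suc N)) sub))

  -- Conversely every t less than n below the head is a content of S:
  -- otherwise the n distinct contents of S fit into t+1, …, t+i with i < n.
  near-head⇒content : ∀ {t i} → i ℕ.< n → t + + i ≡ maxContent S → HasContent S t
  near-head⇒content {t} {i} i<n max≡ with hasContent? S t
  ... | yes has = has
  ... | no ∄ = ⊥-elim (ℕP.<⇒≱ i<n n≤i)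
    where
    sub : ∀ {u} → u ∈ map content S → u ∈ range (t + + 1) i
    sub u∈ with ∈-map⁻ content u∈
    ... | y , y∈ , refl with content y ℤ.≤? t
    ...   | yes y≤t = ⊥-elim (∄ (reach (maxContent-attained S y∈)))
      where
      reach : (∃ λ h → h ∈ S × content h ≡ maxContent S) → HasContent S t
      reach (h , h∈ , h≡) = content-interval connected y∈ h∈ t y≤t (≤-≡ (≤-+ t i) (trans max≡ (sym h≡)))
    ...   | no y≰t with <-witness (ℤP.≰⇒> y≰t)
    ...     | p , y≡ = subst (_∈ range (t + + 1) i) (sym y≡) (∈-range⁺ (t + + 1) i p p<i)
      where
      p<i : p ℕ.< i
      p<i = ℤP.drop‿+≤+ (+-cancelˡ-≤ t (ℤP.≤-trans (≡-≤ (+1-+ t p) (≤-≡ ℤP.≤-refl (sym y≡)))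
              (≤-≡ (maxContent-bound S y∈) (sym max≡))))
    n≤i : n ℕ.≤ i
    n≤i = subst (ℕ._≤ i) (trans (ListP.length-map content S) len)
            (subst (length (map content S) ℕ.≤_) (length-range (t + + 1) i)
              (unique-⊆⇒length≤ (map-unique content uniq (content-injective skew no2x2)) sub))

#content : ℤ → List Box → ℕ
#content t = ΣL (λ b → δ (content b ℤ.≟ t))

#content-absent : ∀ S t → ¬ HasContent S t → #content t S ≡ 0
#content-absent []      t ∄ = refl
#content-absent (x ∷ S) t ∄ with content x ℤ.≟ t
... | yes e = ⊥-elim (∄ (x , here refl , e))
... | no _  = #content-absent S t (λ { (z , z∈ , e) → ∄ (z , there z∈ , e) })

#content-once : ∀ {S} t → Unique S → (∀ {x y} → x ∈ S → y ∈ S → content x ≡ content y → x ≡ y) →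
  HasContent S t → #content t S ≡ 1
#content-once {x ∷ S} t (x∉ ∷ uniq) inj has with content x ℤ.≟ t
... | yes e = cong suc (#content-absent S t λ { (z , z∈ , z≡) →
                All.lookup x∉ z∈ (inj (here refl) (there z∈) (trans e (sym z≡))) })
#content-once {x ∷ S} t (x∉ ∷ uniq) inj (z , here refl , z≡) | no ne = ⊥-elim (ne z≡)
#content-once {x ∷ S} t (x∉ ∷ uniq) inj (z , there z∈ , z≡) | no ne =
  #content-once t uniq (λ a b → inj (there a) (there b)) (z , z∈ , z≡)

#content-strip : ∀ {S n} → IsBorderStrip S → length S ≡ n → ∀ t →
  #content t S ≡ hits n (λ i → t + + i) (maxContent S)
#content-strip {S} {n} strip len t with hasContent? S t
... | yes has with StripContents.content⇒near-head strip len has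
...   | i , i<n , e =
  trans (#content-once t (proj₁ strip) (content-injective (proj₁ (proj₂ (proj₂ strip))) (proj₂ (proj₂ (proj₂ strip)))) has)
        (sym (hits-once n (λ i → t + + i) (maxContent S) (translate-injective t) i i<n e))
#content-strip {S} {n} strip len t | no ∄ =
  trans (#content-absent S t ∄)
        (sym (hits-absent n (λ i → t + + i) (maxContent S) (λ i i<n e → ∄ (StripContents.near-head⇒content strip len i<n e))))

leftCol-bottomRow : ∀ n w → leftCol n w - bottomRow n w ≡ + 1 - + n - + length w
leftCol-bottomRow n [] = square (+ n)
  where
  square : ∀ n → + 0 - (n - + 1) ≡ + 1 - n - + 0
  square = solve-∀
leftCol-bottomRow n (c ∷ w) =
  trans (regroup (leftCol n w) (bottomRow n w))
    (trans (cong (λ z → z - + 1) (leftCol-bottomRow n w))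
      (trans (one-more (+ 1 - + n) (+ length w)) (cong (λ z → + 1 - + n - z) (sym (ℤP.pos-+ 1 (length w))))))
  where
  regroup : ∀ l b → l - + 1 - b ≡ l - b - + 1
  regroup = solve-∀
  one-more : ∀ a k → a - k - + 1 ≡ a - (+ 1 + k)
  one-more = solve-∀
leftCol-bottomRow n (r ∷ w) =
  trans (regroup (leftCol n w) (bottomRow n w))
    (trans (cong (λ z → z - + 1) (leftCol-bottomRow n w))
      (trans (one-more (+ 1 - + n) (+ length w)) (cong (λ z → + 1 - + n - z) (sym (ℤP.pos-+ 1 (length w))))))
  where
  regroup : ∀ l b → l - (b + + 1) ≡ l - b - + 1
  regroup = solve-∀
  one-more : ∀ a k → a - k - + 1 ≡ a - (+ 1 + k)
  one-more = solve-∀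

leftCol≤0 : ∀ n w → leftCol n w ≤ + 0
leftCol≤0 n []      = ℤP.≤-refl
leftCol≤0 n (c ∷ w) = ℤP.≤-trans (ℤP.i-j≤i (leftCol n w) (+ 1)) (leftCol≤0 n w)
leftCol≤0 n (r ∷ w) = leftCol≤0 n w

bottomRow≥ : ∀ n w → + n - + 1 ≤ bottomRow n w
bottomRow≥ n []      = ℤP.≤-refl
bottomRow≥ n (c ∷ w) = bottomRow≥ n w
bottomRow≥ n (r ∷ w) = ℤP.≤-trans (bottomRow≥ n w) (≤-+ _ 1)

newColumn newRow : ℕ → List Letter → List Box
newColumn n w = map (λ i → (i , leftCol n w - + 1)) (range (bottomRow n w - + n + + 1) n)
newRow    n w = map (λ j → (bottomRow n w + + 1 , j)) (range (leftCol n w) n)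

InBoundingBox : ℕ → List Letter → Box → Set
InBoundingBox n w b = (+ 0 ≤ row b) × (row b ≤ bottomRow n w) × (leftCol n w ≤ col b) × (col b ≤ + n - + 1)

<⇒≤-1 : ∀ {p N} → p ℕ.< N → + p ≤ + N - + 1
<⇒≤-1 {p} {suc N} (ℕ.s≤s p≤N) = ≤-≡ (ℤ.+≤+ p≤N) (cancel (+ N))
  where
  cancel : ∀ x → x ≡ + 1 + x - + 1
  cancel = solve-∀

squareRow : ℕ → ℤ → List Box
squareRow n i = map (λ j → (i , j)) (range (+ 0) n)

∈-square⁻ : ∀ n {b} → b ∈ diagram n [] →
  ∃ λ p → ∃ λ q → p ℕ.< n × q ℕ.< n × b ≡ (+ 0 + + p , + 0 + + q)
∈-square⁻ n b∈ with ∈-concat⁻′ (map (squareRow n) (range (+ 0) n)) b∈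
... | bs , b∈bs , bs∈ with ∈-map-range⁻ (squareRow n) (+ 0) n bs∈
...   | p , p<n , refl with ∈-map-range⁻ (λ j → (+ 0 + + p , j)) (+ 0) n b∈bs
...     | q , q<n , refl = p , q , p<n , q<n , refl

diagram-bounds : ∀ n w {b} → b ∈ diagram n w → InBoundingBox n w b
diagram-bounds n [] b∈ with ∈-square⁻ n b∈
... | p , q , p<n , q<n , refl =
  ≤-+ (+ 0) p , ≡-≤ (ℤP.+-identityˡ (+ p)) (<⇒≤-1 p<n) , ≤-+ (+ 0) q , ≡-≤ (ℤP.+-identityˡ (+ q)) (<⇒≤-1 q<n)
diagram-bounds n (c ∷ w) b∈ with ∈-++⁻ (newColumn n w) b∈
... | inj₂ b∈old with diagram-bounds n w b∈old
...   | r0 , r1 , c0 , c1 = r0 , r1 , ℤP.≤-trans (ℤP.i-j≤i _ (+ 1)) c0 , c1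
diagram-bounds n (c ∷ w) b∈ | inj₁ b∈new
  with ∈-map-range⁻ (λ i → (i , leftCol n w - + 1)) (bottomRow n w - + n + + 1) n b∈new
... | p , p<n , refl = top , bottom , ℤP.≤-refl , left
  where
  B : ℤ
  B = bottomRow n w
  top : + 0 ≤ B - + n + + 1 + + p
  top = ℤP.+-mono-≤ (≤-≡ (ℤP.i≤j⇒0≤j-i (bottomRow≥ n w)) (sym (regroup B (+ n)))) (ℤ.+≤+ ℕ.z≤n)
    where
    regroup : ∀ B n → B - n + + 1 ≡ B - (n - + 1)
    regroup = solve-∀
  bottom : B - + n + + 1 + + p ≤ B
  bottom = ≤-≡ (ℤP.+-monoʳ-≤ (B - + n + + 1) (<⇒≤-1 p<n)) (cancel B (+ n))
    where
    cancel : ∀ B n → B - n + + 1 + (n - + 1) ≡ B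
    cancel = solve-∀
  left : leftCol n w - + 1 ≤ + n - + 1
  left = ℤP.+-monoˡ-≤ (- + 1) (ℤP.≤-trans (leftCol≤0 n w) (ℤ.+≤+ {0} {n} ℕ.z≤n))
diagram-bounds n (r ∷ w) b∈ with ∈-++⁻ (newRow n w) b∈
... | inj₂ b∈old with diagram-bounds n w b∈old
...   | r0 , r1 , c0 , c1 = r0 , ℤP.≤-trans r1 (≤-+ _ 1) , c0 , c1
diagram-bounds n (r ∷ w) b∈ | inj₁ b∈new
  with ∈-map-range⁻ (λ j → (bottomRow n w + + 1 , j)) (leftCol n w) n b∈new
... | p , p<n , refl =
  ℤP.≤-trans (ℤ.+≤+ ℕ.z≤n) (ℤP.≤-trans (ℤP.≤-trans (<⇒≤-1 p<n) (bottomRow≥ n w)) (≤-+ _ 1)) ,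
  ℤP.≤-refl , ≤-+ _ p , ≤-≡ (ℤP.+-mono-≤ (leftCol≤0 n w) (<⇒≤-1 p<n)) (ℤP.+-identityˡ _)

diagram-content≤ : ∀ n w {b} → b ∈ diagram n w → content b ≤ + n - + 1
diagram-content≤ n w b∈ with diagram-bounds n w b∈
... | r0 , _ , _ , c1 = ≤-≡ (ℤP.+-mono-≤ c1 (ℤP.neg-mono-≤ r0)) (drop0 (+ n))
  where
  drop0 : ∀ n → n - + 1 + - + 0 ≡ n - + 1
  drop0 = solve-∀

private
  ,-injectiveˡ : ∀ {a b c d : ℤ} → (a , b) ≡ (c , d) → a ≡ c
  ,-injectiveˡ refl = refl

  ,-injectiveʳ : ∀ {a b c d : ℤ} → (a , b) ≡ (c , d) → b ≡ d
  ,-injectiveʳ refl = refl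

diagram-unique : ∀ n w → Unique (diagram n w)
diagram-unique n [] =
  UniqueP.concat⁺ (All.tabulate row-unique) (AllPairsP.map⁺ (AllPairs.map rows-disjoint (range-unique (+ 0) n)))
  where
  row-unique : ∀ {xs} → xs ∈ map (squareRow n) (range (+ 0) n) → Unique xs
  row-unique xs∈ with ∈-map⁻ (squareRow n) xs∈
  ... | i , _ , refl = UniqueP.map⁺ ,-injectiveʳ (range-unique (+ 0) n)
  rows-disjoint : ∀ {i i'} → i ≢ i' → Disjoint (squareRow n i) (squareRow n i')
  rows-disjoint i≢i' (b∈ , b∈') with ∈-map⁻ (λ j → (_ , j)) b∈ | ∈-map⁻ (λ j → (_ , j)) b∈'
  ... | j , _ , refl | j' , _ , e = i≢i' (,-injectiveˡ e)
diagram-unique n (c ∷ w) =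
  UniqueP.++⁺ (UniqueP.map⁺ ,-injectiveˡ (range-unique _ n)) (diagram-unique n w) new-column-fresh
  where
  new-column-fresh : Disjoint (newColumn n w) (diagram n w)
  new-column-fresh (b∈new , b∈old) with ∈-map⁻ (λ i → (i , leftCol n w - + 1)) b∈new
  ... | i , _ , refl with diagram-bounds n w b∈old
  ...   | _ , _ , c0 , _ =
    ℤP.<-irrefl refl (ℤP.<-≤-trans (subst (leftCol n w - + 1 <_) (cancel (leftCol n w)) (<-+1 _)) c0)
    where
    cancel : ∀ L → L - + 1 + + 1 ≡ L
    cancel = solve-∀
diagram-unique n (r ∷ w) =
  UniqueP.++⁺ (UniqueP.map⁺ ,-injectiveʳ (range-unique _ n)) (diagram-unique n w) new-row-fresh
  where
  new-row-fresh : Disjoint (newRow n w) (diagram n w)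
  new-row-fresh (b∈new , b∈old) with ∈-map⁻ (λ j → (bottomRow n w + + 1 , j)) b∈new
  ... | j , _ , refl with diagram-bounds n w b∈old
  ...   | _ , r1 , _ , _ = ℤP.<-irrefl refl (ℤP.<-≤-trans (<-+1 _) r1)

-- Boxes of (w , n) by content.  numberedDiagonal n k u is 1 if u is the
-- content of one of the diagonals numbered 1, …, n+k (that is
-- -k ≤ u ≤ n-1) and 0 otherwise; the diagram has
-- Σ_{i<n} numberedDiagonal n k (t+i) boxes of content t.

numberedDiagonal : ℕ → ℕ → ℤ → ℕ
numberedDiagonal n k = hits (k ℕ.+ n) (λ m → - + k + + m)

numberedDiagonal-suc : ∀ n k u →
  numberedDiagonal n (suc k) u ≡ δ (- + suc k + + 0 ℤ.≟ u) ℕ.+ numberedDiagonal n k u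
numberedDiagonal-suc n k u =
  cong (δ (- + suc k + + 0 ℤ.≟ u) ℕ.+_) (Σ<-cong (k ℕ.+ n) (λ m → cong (λ z → δ (z ℤ.≟ u)) (shift m)))
  where
  cancel : ∀ K M → - (+ 1 + K) + (+ 1 + M) ≡ - K + M
  cancel = solve-∀
  shift : ∀ m → - + suc k + + suc m ≡ - + k + + m
  shift m = trans (cong₂ (λ a b → - a + b) (ℤP.pos-+ 1 k) (ℤP.pos-+ 1 m)) (cancel (+ k) (+ m))

numberedDiagonal-vanishes : ∀ n k u → + n - + 1 < u → numberedDiagonal n k u ≡ 0
numberedDiagonal-vanishes n k u n-1<u = hits-absent (k ℕ.+ n) (λ i → - + k + + i) u below
  where
  top : ∀ k n → - k + (k + n - + 1) ≡ n - + 1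
  top = solve-∀
  below : ∀ i → i ℕ.< k ℕ.+ n → - + k + + i ≢ u
  below i i<k+n refl = ℤP.<-irrefl refl (ℤP.<-≤-trans n-1<u
    (≤-≡ (ℤP.+-monoʳ-≤ (- + k) (<⇒≤-1 i<k+n)) (trans (cong (λ z → - + k + (z - + 1)) (ℤP.pos-+ k n)) (top (+ k) (+ n)))))

private
  shift⇒ : ∀ {X Y t} d → Y ≡ X + d → X ≡ t → Y ≡ t + d
  shift⇒ d Y≡ refl = Y≡

  shift⇐ : ∀ {X Y t} d → Y ≡ X + d → Y ≡ t + d → X ≡ t
  shift⇐ {X} {Y} {t} d Y≡ Y≡' = trans (cancel X d) (trans (cong (λ z → z - d) (trans (sym Y≡) Y≡')) (sym (cancel t d)))
    where
    cancel : ∀ x d → x ≡ x + d - d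
    cancel = solve-∀

  ΣL-range : ∀ (g : ℤ → ℕ) a N → ΣL g (range a N) ≡ Σ< N (λ j → g (a + + j))
  ΣL-range g a zero    = refl
  ΣL-range g a (suc N) = cong₂ ℕ._+_ (cong g (sym (ℤP.+-identityʳ a)))
    (trans (ΣL-range g (a + + 1) N) (Σ<-cong N (λ j → cong g (sym (+1-+ a j)))))

  +-∸-suc : ∀ {p n} → p ℕ.< n → + (n ℕ.∸ suc p) ≡ + n - + 1 - + p
  +-∸-suc {p} {n} p<n =
    trans (regroup (+ (n ℕ.∸ suc p)) (+ p))
      (cong (λ z → z - + 1 - + p) (trans (sym (ℤP.pos-+ (n ℕ.∸ suc p) (suc p))) (cong +_ (ℕP.m∸n+n≡m p<n))))
    where
    regroup : ∀ x p → x ≡ x + (+ 1 + p) - + 1 - p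
    regroup = solve-∀

  ∸-suc< : ∀ {p n} → p ℕ.< n → n ℕ.∸ suc p ℕ.< n
  ∸-suc< {p} {suc n} _ = ℕ.s≤s (ℕP.m∸n≤m n p)

  extend : ∀ n w t new →
    #content t new ≡ Σ< n (λ i → δ (- + suc (length w) + + 0 ℤ.≟ t + + i)) →
    #content t (diagram n w) ≡ Σ< n (λ i → numberedDiagonal n (length w) (t + + i)) →
    #content t (new ++ diagram n w) ≡ Σ< n (λ i → numberedDiagonal n (suc (length w)) (t + + i))
  extend n w t new new-count old-count = begin
    #content t (new ++ diagram n w)                       ≡⟨ ΣL-++ (λ b → δ (content b ℤ.≟ t)) new (diagram n w) ⟩
    #content t new ℕ.+ #content t (diagram n w)           ≡⟨ cong₂ ℕ._+_ new-count old-count ⟩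
    Σ< n (λ i → δ (V ℤ.≟ t + + i)) ℕ.+ Σ< n (λ i → numberedDiagonal n k (t + + i))
                                                          ≡⟨ Σ<-+ n _ _ ⟨
    Σ< n (λ i → δ (V ℤ.≟ t + + i) ℕ.+ numberedDiagonal n k (t + + i))
                                                          ≡⟨ Σ<-cong n (λ i → numberedDiagonal-suc n k (t + + i)) ⟨
    Σ< n (λ i → numberedDiagonal n (suc k) (t + + i))     ∎
    where
    open ≡-Reasoning
    k : ℕ
    k = length w
    V : ℤ
    V = - + suc k + + 0

-- V = -(k+1) is the content of the diagonal added by a letter to a word of
-- length k.  The new column has the n contents V, V-1, …, V-n+1, so it
-- has a box of content t iff t + i = V for some i < n.
#content-newColumn : ∀ n w t →
  #content t (newColumn n w) ≡ Σ< n (λ i → δ (- + suc (length w) + + 0 ℤ.≟ t + + i))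
#content-newColumn n w t =
  trans (ΣL-map (λ b → δ (content b ℤ.≟ t)) (λ i → (i , L - + 1)) (range (B - + n + + 1) n))
  (trans (ΣL-range (λ i → δ (content (i , L - + 1) ℤ.≟ t)) (B - + n + + 1) n)
  (trans (hits-cong n n g (λ i → t + + i) t V g-injective (translate-injective t)
            (λ { (p , p<n , e) → p , p<n , sym (shift⇒ (+ p) (cancel V p) (trans (sym (g≡ p)) e)) })
            (λ { (p , p<n , e) → p , p<n , trans (g≡ p) (shift⇐ (+ p) (cancel V p) (sym e)) }))
     (Σ<-cong n (λ i → δ-sym (t + + i) V))))
  where
  k : ℕ
  k = length w
  L B V : ℤ
  L = leftCol n w
  B = bottomRow n w
  V = - + suc k + + 0
  g : ℕ → ℤ
  g p = content (B - + n + + 1 + + p , L - + 1)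
  g≡ : ∀ p → g p ≡ V - + p
  g≡ p = trans (regroup L B (+ n) (+ p))
           (trans (cong (λ z → z + + n - + 2 - + p) (leftCol-bottomRow n w)) (simplify (+ n) (+ k) (+ p)))
    where
    regroup : ∀ L B n p → L - + 1 - (B - n + + 1 + p) ≡ L - B + n - + 2 - p
    regroup = solve-∀
    simplify : ∀ n k p → + 1 - n - k + n - + 2 - p ≡ - (+ 1 + k) + + 0 - p
    simplify = solve-∀
  g-injective : ∀ p q → g p ≡ g q → p ≡ q
  g-injective p q e = ℤP.+-injective (ℤP.neg-injective (+-cancelˡ V (trans (sym (g≡ p)) (trans e (g≡ q)))))
  cancel′ : ∀ V p → V ≡ V - p + p
  cancel′ = solve-∀
  cancel : ∀ V p → V ≡ V - + p + + p
  cancel V p = cancel′ V (+ p)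

-- The new row has the n contents V-n+1, …, V; its box of content V-n+1+p
-- corresponds to the index n-1-p.
#content-newRow : ∀ n w t →
  #content t (newRow n w) ≡ Σ< n (λ i → δ (- + suc (length w) + + 0 ℤ.≟ t + + i))
#content-newRow n w t =
  trans (ΣL-map (λ b → δ (content b ℤ.≟ t)) (λ j → (B + + 1 , j)) (range L n))
  (trans (ΣL-range (λ j → δ (content (B + + 1 , j) ℤ.≟ t)) L n)
  (trans (hits-cong n n g (λ i → t + + i) t V g-injective (translate-injective t)
            (λ { (p , p<n , e) → n ℕ.∸ suc p , ∸-suc< p<n ,
                   trans (cong₂ _+_ (sym e) (+-∸-suc p<n))
                     (trans (cong (λ z → z + (+ n - + 1 - + p)) (g≡ p)) (reflect V (+ n) (+ p))) })
            (λ { (i , i<n , e) → n ℕ.∸ suc i , ∸-suc< i<n ,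
                   trans (g≡ _) (trans (cong (λ z → K + z) (+-∸-suc i<n))
                     (trans (reflect′ V (+ n) (+ i)) (trans (cong (λ z → z - + i) (sym e)) (sym (cancel t (+ i)))))) }))
     (Σ<-cong n (λ i → δ-sym (t + + i) V))))
  where
  k : ℕ
  k = length w
  L B V : ℤ
  L = leftCol n w
  B = bottomRow n w
  V = - + suc k + + 0
  K : ℤ
  K = V - + n + + 1
  g : ℕ → ℤ
  g p = content (B + + 1 , L + + p)
  g≡ : ∀ p → g p ≡ K + + p
  g≡ p = trans (regroup L B (+ p)) (trans (cong (λ z → z - + 1 + + p) (leftCol-bottomRow n w)) (simplify (+ n) (+ k) (+ p)))
    where
    regroup : ∀ L B p → L + p - (B + + 1) ≡ L - B - + 1 + p
    regroup = solve-∀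
    simplify : ∀ n k p → + 1 - n - k - + 1 + p ≡ - (+ 1 + k) + + 0 - n + + 1 + p
    simplify = solve-∀
  g-injective : ∀ p q → g p ≡ g q → p ≡ q
  g-injective p q e = translate-injective K p q (trans (sym (g≡ p)) (trans e (g≡ q)))
  reflect : ∀ V n p → V - n + + 1 + p + (n - + 1 - p) ≡ V
  reflect = solve-∀
  reflect′ : ∀ V n i → V - n + + 1 + (n - + 1 - i) ≡ V - i
  reflect′ = solve-∀
  cancel : ∀ t i → t ≡ t + i - i
  cancel = solve-∀

-- The square has one box on each of the diagonals of contents -(n-1) … n-1
-- (multiplicity as Σ_{i<n} of the indicator of 0 … n-1); each letter adds
-- the next lower diagonal.
#content-diagram : ∀ n w t → #content t (diagram n w) ≡ Σ< n (λ i → numberedDiagonal n (length w) (t + + i))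
#content-diagram n [] t =
  trans (ΣL-concat (λ b → δ (content b ℤ.≟ t)) (map (squareRow n) (range (+ 0) n)))
  (trans (ΣL-map (#content t) (squareRow n) (range (+ 0) n))
  (trans (ΣL-range (λ i → #content t (squareRow n i)) (+ 0) n)
  (Σ<-cong n λ i → trans (ΣL-map (λ b → δ (content b ℤ.≟ t)) (λ j → (+ 0 + + i , j)) (range (+ 0) n))
     (trans (ΣL-range (λ j → δ (content (+ 0 + + i , j) ℤ.≟ t)) (+ 0) n)
       (Σ<-cong n λ j → δ-cong (shift⇒ (+ 0 + + i) (regroup (+ i) (+ j))) (shift⇐ (+ 0 + + i) (regroup (+ i) (+ j))) _ _)))))
  where
  regroup : ∀ i j → - + 0 + j ≡ + 0 + j - (+ 0 + i) + (+ 0 + i)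
  regroup = solve-∀
#content-diagram n (c ∷ w) t = extend n w t (newColumn n w) (#content-newColumn n w t) (#content-diagram n w t)
#content-diagram n (r ∷ w) t = extend n w t (newRow n w) (#content-newRow n w t) (#content-diagram n w t)

module Satisfying {A : Set} {P : A → Set} (P? : ∀ x → Dec (P x)) where

  #satisfying : List A → ℕ
  #satisfying = ΣL (λ x → δ (P? x))

  private
    none : ∀ (xs : List A) → #satisfying xs ≡ 0 → ∀ j → ¬ P (lookup xs j)
    none (x ∷ xs) e j p with P? x
    none (x ∷ xs) e j          p | yes _ = ℕP.0≢1+n (sym e)
    none (x ∷ xs) e Fin.zero    p | no ¬p = ¬p p
    none (x ∷ xs) e (Fin.suc j) p | no ¬p = none xs e j p

    positive : ∀ {x} (xs : List A) → x ∈ xs → P x → 1 ℕ.≤ #satisfying xs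
    positive (y ∷ xs) (here refl) p with P? y
    ... | yes _ = ℕ.s≤s ℕ.z≤n
    ... | no ¬p = ⊥-elim (¬p p)
    positive (y ∷ xs) (there x∈) p = ℕP.≤-trans (positive xs x∈ p) (ℕP.m≤n+m _ (δ (P? y)))

  unique-position : ∀ (xs : List A) → #satisfying xs ≡ 1 →
    ∃ λ i → P (lookup xs i) × (∀ j → P (lookup xs j) → j ≡ i)
  unique-position (x ∷ xs) e with P? x
  ... | yes p = Fin.zero , p , λ { Fin.zero _ → refl ; (Fin.suc j) q → ⊥-elim (none xs (ℕP.suc-injective e) j q) }
  ... | no ¬p with unique-position xs e
  ...   | i , p , only = Fin.suc i , p , λ { Fin.zero q → ⊥-elim (¬p q) ; (Fin.suc j) q → cong Fin.suc (only j q) }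

  at-most-one : ∀ {x y} (xs : List A) → #satisfying xs ℕ.≤ 1 → x ∈ xs → y ∈ xs → P x → P y → x ≡ y
  at-most-one (z ∷ xs) le (here refl) (here refl) px py = refl
  at-most-one (z ∷ xs) le (here refl) (there y∈) px py with P? z
  ... | yes _ = ⊥-elim (ℕP.<⇒≱ (ℕ.s≤s (positive xs y∈ py)) le)
  ... | no ¬p = ⊥-elim (¬p px)
  at-most-one (z ∷ xs) le (there x∈) (here refl) px py with P? z
  ... | yes _ = ⊥-elim (ℕP.<⇒≱ (ℕ.s≤s (positive xs x∈ px)) le)
  ... | no ¬p = ⊥-elim (¬p py)
  at-most-one (z ∷ xs) le (there x∈) (there y∈) px py =
    at-most-one xs (ℕP.≤-trans (ℕP.m≤n+m _ (δ (P? z))) le) x∈ y∈ px py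

private
  ++-disjoint : ∀ {A : Set} {x : A} xs {ys} → Unique (xs ++ ys) → x ∈ xs → x ∈ ys → ⊥
  ++-disjoint (z ∷ xs) (z∉ ∷ _)    (here refl) x∈ys = All.lookup z∉ (∈-++⁺ʳ xs x∈ys) refl
  ++-disjoint (z ∷ xs) (_ ∷ uniq) (there x∈)  x∈ys = ++-disjoint xs uniq x∈ x∈ys

  ++-uniqueʳ : ∀ {A : Set} xs {ys : List A} → Unique (xs ++ ys) → Unique ys
  ++-uniqueʳ []       uniq       = uniq
  ++-uniqueʳ (x ∷ xs) (_ ∷ uniq) = ++-uniqueʳ xs uniq

strip-unique : ∀ {x} {S₁ S₂ : List Box} (D : List (List Box)) → Unique (concat D) →
  S₁ ∈ D → S₂ ∈ D → x ∈ S₁ → x ∈ S₂ → S₁ ≡ S₂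
strip-unique (T ∷ D) uniq (here refl) (here refl) _  _  = refl
strip-unique (T ∷ D) uniq (here refl) (there S₂∈) x₁ x₂ = ⊥-elim (++-disjoint T uniq x₁ (∈-concat⁺′ x₂ S₂∈))
strip-unique (T ∷ D) uniq (there S₁∈) (here refl) x₁ x₂ = ⊥-elim (++-disjoint T uniq x₂ (∈-concat⁺′ x₁ S₁∈))
strip-unique (T ∷ D) uniq (there S₁∈) (there S₂∈) x₁ x₂ = strip-unique D (++-uniqueʳ T uniq) S₁∈ S₂∈ x₁ x₂

module Decomposition (w : List Letter) (m : ℕ) (D : List (List Box)) (bsd : IsBSD w (suc m) D) where

  n k : ℕ
  n = suc m
  k = length w

  private
    strips : ∀ {S} → S ∈ D → IsBorderStrip S × length S ≡ n
    strips = proj₁ bsd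
    perm : concat D ↭ diagram n w
    perm = proj₂ bsd

  strip : ∀ {S} → S ∈ D → IsBorderStrip S
  strip S∈ = proj₁ (strips S∈)

  strip-length : ∀ {S} → S ∈ D → length S ≡ n
  strip-length S∈ = proj₂ (strips S∈)

  strip-content-injective : ∀ {S} → S ∈ D → ∀ {x y} → x ∈ S → y ∈ S → content x ≡ content y → x ≡ y
  strip-content-injective S∈ = content-injective (proj₁ (proj₂ (proj₂ (strip S∈)))) (proj₂ (proj₂ (proj₂ (strip S∈))))

  strip-successor : ∀ {S} → S ∈ D → ∀ {x z} → x ∈ S → z ∈ S → content z ≡ content x + + 1 → z ≡ up x ⊎ z ≡ right x
  strip-successor S∈ = successor-up-or-right (proj₁ (proj₂ (proj₂ (strip S∈)))) (proj₂ (proj₂ (proj₂ (strip S∈))))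

  in-diagram : ∀ {x S} → S ∈ D → x ∈ S → x ∈ diagram n w
  in-diagram S∈ x∈ = PermP.∈-resp-↭ perm (∈-concat⁺′ x∈ S∈)

  strip-of : ∀ {x} → x ∈ diagram n w → ∃ λ S → S ∈ D × x ∈ S
  strip-of x∈ with ∈-concat⁻′ D (PermP.∈-resp-↭ (↭-sym perm) x∈)
  ... | S , x∈S , S∈ = S , S∈ , x∈S

  boxes-unique : Unique (concat D)
  boxes-unique = PermSetoidP.Unique-resp-↭ (setoid Box) (↭⇒↭ₛ (↭-sym perm)) (diagram-unique n w)

  private
    nonempty : ∀ {S : List Box} → length S ≡ n → ∃ λ x → x ∈ S
    nonempty {x ∷ _} _ = x , here refl

  head-of : ∀ {S} → S ∈ D → ∃ λ h → h ∈ S × content h ≡ maxContent S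
  head-of {S} S∈ = maxContent-attained S (proj₂ (nonempty (strip-length S∈)))

  headsAt : ℤ → ℕ
  headsAt u = Satisfying.#satisfying (λ S → u ℤ.≟ maxContent S) D

  -- Counting the boxes of content t strip by strip and on the diagram.
  headsAt-windows : ∀ t → Σ< n (λ i → headsAt (t + + i)) ≡ Σ< n (λ i → numberedDiagonal n k (t + + i))
  headsAt-windows t = begin
    Σ< n (λ i → headsAt (t + + i))                    ≡⟨ ΣL-Σ< n (λ S i → δ (t + + i ℤ.≟ maxContent S)) D ⟨
    ΣL (λ S → hits n (λ i → t + + i) (maxContent S)) D ≡⟨ ΣL-cong D (λ S∈ → #content-strip (strip S∈) (strip-length S∈) t) ⟨
    ΣL (#content t) D                                 ≡⟨ ΣL-concat (λ b → δ (content b ℤ.≟ t)) D ⟨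
    #content t (concat D)                             ≡⟨ ΣL-↭ (λ b → δ (content b ℤ.≟ t)) perm ⟩
    #content t (diagram n w)                          ≡⟨ #content-diagram n w t ⟩
    Σ< n (λ i → numberedDiagonal n k (t + + i))       ∎
    where open ≡-Reasoning

  private
    maxContent≤ : ∀ {S} → S ∈ D → maxContent S ≤ + n - + 1
    maxContent≤ S∈ with head-of S∈
    ... | h , h∈ , h≡ = ≡-≤ (sym h≡) (diagram-content≤ n w (in-diagram S∈ h∈))

    headsAt-vanishes : ∀ u → + n - + 1 < u → headsAt u ≡ 0
    headsAt-vanishes u n-1<u = trans (ΣL-cong D none) (ΣL-zero D)
      where
      none : ∀ {S} → S ∈ D → δ (u ℤ.≟ maxContent S) ≡ 0
      none {S} S∈ with u ℤ.≟ maxContent S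
      ... | yes e = ⊥-elim (ℤP.<-irrefl refl (ℤP.<-≤-trans n-1<u (≡-≤ e (maxContent≤ S∈))))
      ... | no _  = refl
      ΣL-zero : ∀ (xs : List (List Box)) → ΣL (λ _ → 0) xs ≡ 0
      ΣL-zero []       = refl
      ΣL-zero (_ ∷ xs) = ΣL-zero xs
  headsAt≡numberedDiagonal : ∀ u → headsAt u ≡ numberedDiagonal n k u
  headsAt≡numberedDiagonal =
    WindowSums.agree m headsAt (numberedDiagonal n k) (+ n - + 1) headsAt-vanishes (numberedDiagonal-vanishes n k) headsAt-windows

  headsAt≤1 : ∀ u → headsAt u ℕ.≤ 1
  headsAt≤1 u = subst (ℕ._≤ 1) (sym (headsAt≡numberedDiagonal u))
                  (hits≤1 (k ℕ.+ n) (λ i → - + k + + i) u (translate-injective (- + k)))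

  same-head⇒same-strip : ∀ {S T} → S ∈ D → T ∈ D → maxContent S ≡ maxContent T → S ≡ T
  same-head⇒same-strip {S} S∈ T∈ e =
    Satisfying.at-most-one (λ X → maxContent S ℤ.≟ maxContent X) D (headsAt≤1 (maxContent S)) S∈ T∈ refl e

  -- The diagonal numbered d+1 has content -k+d, and carries one head.
  heads-on-numbered-diagonal : ∀ d → d ℕ.< k ℕ.+ n → headsAt (diagContent n k (suc d)) ≡ 1
  heads-on-numbered-diagonal d d<k+n =
    trans (headsAt≡numberedDiagonal _) (hits-once (k ℕ.+ n) (λ i → - + k + + i) _ (translate-injective (- + k)) d d<k+n content≡)
    where
    regroup : ∀ n k d → - k + d ≡ (n - + 1) - ((n + k) - (+ 1 + d))
    regroup = solve-∀
    content≡ : - + k + + d ≡ diagContent n k (suc d)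
    content≡ = trans (regroup (+ n) (+ k) (+ d))
      (cong₂ (λ a b → (+ n - + 1) - (a - b)) (sym (ℤP.pos-+ n k)) (sym (ℤP.pos-+ 1 d)))

  headOnDiag⇒ : ∀ {d S} → HeadOnDiag n k d S → diagContent n k d ≡ maxContent S
  headOnDiag⇒ (h , head , h≡) = trans (sym h≡) (head⇒maxContent head)

  headOnDiag⇐ : ∀ {d S} → S ∈ D → diagContent n k d ≡ maxContent S → HeadOnDiag n k d S
  headOnDiag⇐ S∈ e with head-of S∈
  ... | h , h∈ , h≡ = h , maxContent⇒head h∈ h≡ , trans h≡ (sym e)

  one-head-per-diagonal : ∀ d → 1 ℕ.≤ d → d ℕ.≤ n ℕ.+ k →
    ∃[ i ] (HeadOnDiag n k d (lookup D i) × ((j : Fin (length D)) → HeadOnDiag n k d (lookup D j) → j ≡ i))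
  one-head-per-diagonal (suc d) _ d<n+k
    with Satisfying.unique-position (λ S → diagContent n k (suc d) ℤ.≟ maxContent S) D
           (heads-on-numbered-diagonal d (subst (suc d ℕ.≤_) (ℕP.+-comm n k) d<n+k))
  ... | i , on-d , only = i , headOnDiag⇐ {suc d} (∈-lookup i) on-d , λ j on-d′ → only j (headOnDiag⇒ {suc d} on-d′)

  continues : ∀ {S x} → S ∈ D → x ∈ S → content x ≢ maxContent S → up x ∈ S ⊎ right x ∈ S
  continues {S} {x} S∈ x∈ not-head with head-of S∈ | <-witness (ℤP.≤∧≢⇒< (maxContent-bound S x∈) not-head)
  ... | h , h∈ , h≡ | p , max≡
    with content-interval (proj₁ (proj₂ (strip S∈))) x∈ h∈ (content x + + 1) (≤-+ _ 1)
           (≤-≡ (≤-+ _ p) (trans (sym max≡) (sym h≡)))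
  ... | z , z∈ , z≡ with strip-successor S∈ x∈ z∈ z≡
  ... | inj₁ refl = inj₁ z∈
  ... | inj₂ refl = inj₂ z∈

SameHeadContent : List (List Box) → List (List Box) → Box → Set
SameHeadContent D D' x = ∀ {S S'} → S ∈ D → x ∈ S → S' ∈ D' → x ∈ S' → maxContent S ≡ maxContent S'

SameHeadContent-sym : ∀ {D D' x} → SameHeadContent D D' x → SameHeadContent D' D x
SameHeadContent-sym same S∈ x∈ S'∈ x∈' = sym (same S'∈ x∈' S∈ x∈)

module TwoDecompositions (w : List Letter) (m : ℕ) (D₁ D₂ : List (List Box))
  (bsd₁ : IsBSD w (suc m) D₁) (bsd₂ : IsBSD w (suc m) D₂) where

  module Dec₁ = Decomposition w m D₁ bsd₁
  module Dec₂ = Decomposition w m D₂ bsd₂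

  same-head⇒same-diagonals : ∀ {S₁ S₂ x} → S₁ ∈ D₁ → x ∈ S₁ → S₂ ∈ D₂ →
    maxContent S₁ ≡ maxContent S₂ → HasContent S₂ (content x)
  same-head⇒same-diagonals S₁∈ x∈ S₂∈ same-head
    with StripContents.content⇒near-head (Dec₁.strip S₁∈) (Dec₁.strip-length S₁∈) (_ , x∈ , refl)
  ... | i , i<n , near = StripContents.near-head⇒content (Dec₂.strip S₂∈) (Dec₂.strip-length S₂∈) i<n (trans near same-head)

  -- Let S'' ∈ D₂ contain up x; it has the
  -- head of S₁, so a box y of content x from which it continues to up x.
  -- Either y = x, and S'' = S₂ would hold up x and right x on one diagonal,
  -- or y lies above x, and its strip in D₁ is S₁, which has no second box
  -- on that diagonal.
  no-crossing : ∀ x →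
    (∀ y → content y ≡ content x + + 1 → SameHeadContent D₁ D₂ y) →
    (∀ y → content y ≡ content x → row y < row x → SameHeadContent D₁ D₂ y) →
    ∀ {S₁ S₂} → S₁ ∈ D₁ → x ∈ S₁ → up x ∈ S₁ → S₂ ∈ D₂ → x ∈ S₂ → right x ∈ S₂ → ⊥
  no-crossing x next-diagonal higher {S₁} {S₂} S₁∈ x∈₁ up∈₁ S₂∈ x∈₂ right∈₂
    with Dec₂.strip-of (Dec₁.in-diagram S₁∈ up∈₁)
  ... | S'' , S''∈ , up∈'' with next-diagonal (up x) (content-up x) S₁∈ up∈₁ S''∈ up∈''
  ...   | same-head with same-head⇒same-diagonals S₁∈ x∈₁ S''∈ same-head
  ...     | y , y∈ , y≡ with Dec₂.strip-successor S''∈ y∈ up∈'' (trans (content-up x) (cong (λ z → z + + 1) (sym y≡)))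
  ... | inj₁ up-x≡up-y = up≢right x (Dec₂.strip-content-injective S₂∈ up∈₂ right∈₂
                            (trans (content-up x) (sym (content-right x))))
    where
    y≡x : y ≡ x
    y≡x = cong₂ _,_ (sym (pred-injective (cong proj₁ up-x≡up-y))) (sym (cong proj₂ up-x≡up-y))
      where
      pred-injective : ∀ {a b} → a - + 1 ≡ b - + 1 → a ≡ b
      pred-injective {a} {b} e = trans (cancel a) (trans (cong (λ z → z + + 1) e) (sym (cancel b)))
        where
        cancel : ∀ a → a ≡ a - + 1 + + 1
        cancel = solve-∀
    up∈₂ : up x ∈ S₂
    up∈₂ = subst (up x ∈_) (strip-unique D₂ Dec₂.boxes-unique S''∈ S₂∈ (subst (_∈ S'') y≡x y∈) x∈₂) up∈''
  ... | inj₂ up-x≡right-y with Dec₁.strip-of (Dec₂.in-diagram S''∈ y∈)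
  ...   | T , T∈ , y∈T = ℤP.<-irrefl (cong proj₁ y≡x) y-above
    where
    y-above : row y < row x
    y-above = witness⇒< 0 (trans (cancel (proj₁ x)) (cong (λ z → z + + 1 + + 0) (cong proj₁ up-x≡right-y)))
      where
      cancel : ∀ a → a ≡ a - + 1 + + 1 + + 0
      cancel = solve-∀
    T≡S₁ : T ≡ S₁
    T≡S₁ = Dec₁.same-head⇒same-strip T∈ S₁∈ (trans (higher y y≡ y-above T∈ y∈T S''∈ y∈) (sym same-head))
    y≡x : y ≡ x
    y≡x = Dec₁.strip-content-injective S₁∈ (subst (y ∈_) T≡S₁ y∈T) x∈₁ y≡

-- Two decompositions with the same heads agree box by box, by induction on
-- the distance of a box below the top diagonal (content n-1) and, within a
-- diagonal, on its row.
module SameHeadsAgreement (w : List Letter) (m : ℕ) (D D' : List (List Box))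
  (bsd : IsBSD w (suc m) D) (bsd' : IsBSD w (suc m) D') (same-heads : SameHeads D D') where

  open TwoDecompositions w m D D' bsd bsd'
  private
    module Swapped = TwoDecompositions w m D' D bsd' bsd
    n : ℕ
    n = suc m

  -- At a head the statement is the hypothesis; elsewhere both strips
  -- continue to the next diagonal, in the same direction by no-crossing.
  agreement-step : ∀ x →
    (∀ y → content y ≡ content x + + 1 → SameHeadContent D D' y) →
    (∀ y → content y ≡ content x → row y < row x → SameHeadContent D D' y) →
    SameHeadContent D D' x
  agreement-step x next-diagonal higher {S} {S'} S∈ x∈ S'∈ x∈'
    with content x ℤ.≟ maxContent S | content x ℤ.≟ maxContent S'
  ... | yes head | _ with Equivalence.to (same-heads x) (S , S∈ , maxContent⇒head x∈ head)
  ...   | T , T∈ , head' =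
    trans (sym head) (trans (head⇒maxContent head') (cong maxContent (strip-unique D' Dec₂.boxes-unique T∈ S'∈ (proj₁ head') x∈')))
  agreement-step x next-diagonal higher {S} {S'} S∈ x∈ S'∈ x∈' | no _ | yes head'
    with Equivalence.from (same-heads x) (S' , S'∈ , maxContent⇒head x∈' head')
  ... | T , T∈ , head =
    trans (cong maxContent (strip-unique D Dec₁.boxes-unique S∈ T∈ x∈ (proj₁ head))) (trans (sym (head⇒maxContent head)) head')
  agreement-step x next-diagonal higher {S} {S'} S∈ x∈ S'∈ x∈' | no not-head | no not-head'
    with Dec₁.continues S∈ x∈ not-head | Dec₂.continues S'∈ x∈' not-head'
  ... | inj₁ up∈    | inj₁ up∈'    = next-diagonal (up x) (content-up x) S∈ up∈ S'∈ up∈'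
  ... | inj₂ right∈ | inj₂ right∈' = next-diagonal (right x) (content-right x) S∈ right∈ S'∈ right∈'
  ... | inj₁ up∈    | inj₂ right∈' = ⊥-elim (no-crossing x next-diagonal higher S∈ x∈ up∈ S'∈ x∈' right∈')
  ... | inj₂ right∈ | inj₁ up∈'    = ⊥-elim (Swapped.no-crossing x
          (λ y y≡ → SameHeadContent-sym (next-diagonal y y≡)) (λ y y≡ y< → SameHeadContent-sym (higher y y≡ y<))
          S'∈ x∈' up∈' S∈ x∈ right∈)

  AtDistance : ℕ → Set
  AtDistance a = ∀ x → + n - + 1 ≡ content x + + a → SameHeadContent D D' x

  along-diagonal : ∀ a →
    (∀ x → + n - + 1 ≡ content x + + a → ∀ y → content y ≡ content x + + 1 → SameHeadContent D D' y) →
    AtDistance a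
  along-diagonal a next-diagonal x x≡ S∈ x∈ with ≤-witness (proj₁ (diagram-bounds n w (Dec₁.in-diagram S∈ x∈)))
  ... | ρ , row≡ = by-row ρ x (trans row≡ (ℤP.+-identityˡ (+ ρ))) x≡ S∈ x∈
    where
    OnRow : ℕ → Set
    OnRow ρ = ∀ x → row x ≡ + ρ → + n - + 1 ≡ content x + + a → SameHeadContent D D' x
    by-row : ∀ ρ → OnRow ρ
    by-row = <-rec OnRow λ ρ on-higher-rows x row≡ x≡ →
      agreement-step x (next-diagonal x x≡) λ y y≡ y<x T∈ y∈ →
        let ρ' , row≡' = ≤-witness (proj₁ (diagram-bounds n w (Dec₁.in-diagram T∈ y∈)))
            row-y = trans row≡' (ℤP.+-identityˡ (+ ρ'))
        in on-higher-rows (ℤP.drop‿+<+ (subst₂ _<_ row-y row≡ y<x)) y row-y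
             (trans x≡ (cong (λ z → z + + a) (sym y≡))) T∈ y∈

  by-distance : ∀ a → AtDistance a
  by-distance a = along-diagonal a (next-diagonal a)
    where
    -- nothing lies above the top diagonal; otherwise use distance a - 1
    next-diagonal : ∀ a x → + n - + 1 ≡ content x + + a →
      ∀ y → content y ≡ content x + + 1 → SameHeadContent D D' y
    next-diagonal zero x x≡ y y≡ S∈ y∈ _ _ =
      ⊥-elim (ℤP.<-irrefl refl (ℤP.<-≤-trans (<-+1 (content x))
        (ℤP.≤-trans (≡-≤ (sym y≡) (diagram-content≤ n w (Dec₁.in-diagram S∈ y∈))) (≤-≡ ℤP.≤-refl (trans x≡ (ℤP.+-identityʳ _))))))
    next-diagonal (suc a) x x≡ y y≡ =
      by-distance a y (trans x≡ (trans (+1-+ (content x) a) (cong (λ z → z + + a) (sym y≡))))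

  agreement : ∀ x → SameHeadContent D D' x
  agreement x S∈ x∈ with ≤-witness (diagram-content≤ n w (Dec₁.in-diagram S∈ x∈))
  ... | a , top≡ = by-distance a x top≡ S∈ x∈

  same-partition : SamePartition D D'
  same-partition a b =
    mk⇔ (transfer Dec₁.in-diagram Dec₂.strip-of Dec₂.same-head⇒same-strip (λ S∈ x∈ S'∈ x∈' → agreement _ S∈ x∈ S'∈ x∈'))
        (transfer Dec₂.in-diagram Dec₁.strip-of Dec₁.same-head⇒same-strip (λ S'∈ x∈' S∈ x∈ → sym (agreement _ S∈ x∈ S'∈ x∈')))
    where
    transfer : ∀ {E E'} →
      (∀ {x S} → S ∈ E → x ∈ S → x ∈ diagram n w) →
      (∀ {x} → x ∈ diagram n w → ∃ λ S → S ∈ E' × x ∈ S) →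
      (∀ {S T} → S ∈ E' → T ∈ E' → maxContent S ≡ maxContent T → S ≡ T) →
      (∀ {x S S'} → S ∈ E → x ∈ S → S' ∈ E' → x ∈ S' → maxContent S ≡ maxContent S') →
      SameStrip E a b → SameStrip E' a b
    transfer in-diagram strip-of′ same-strip′ agree (S , S∈ , a∈ , b∈)
      with strip-of′ (in-diagram S∈ a∈) | strip-of′ (in-diagram S∈ b∈)
    ... | Sa , Sa∈ , a∈′ | Sb , Sb∈ , b∈′ =
      Sa , Sa∈ , a∈′ , subst (b ∈_) (same-strip′ Sb∈ Sa∈ (trans (sym (agree S∈ b∈ Sb∈ b∈′)) (agree S∈ a∈ Sa∈ a∈′))) b∈′

mainTheorem7 : (w : List Letter) (n : ℕ) → 1 ℕ.≤ n →
    ((D : List (List Box)) → IsBSD w n D →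
      (d : ℕ) → 1 ℕ.≤ d → d ℕ.≤ n ℕ.+ length w →
      ∃[ i ] (HeadOnDiag n (length w) d (lookup D i) ×
        ((j : Fin (length D)) → HeadOnDiag n (length w) d (lookup D j) → j ≡ i)))
    ×
    ((D D' : List (List Box)) → IsBSD w n D → IsBSD w n D' →
      SameHeads D D' → SamePartition D D')
mainTheorem7 w (suc m) _ =
  (λ D bsd → Decomposition.one-head-per-diagonal w m D bsd) ,
  (λ D D' bsd bsd' same-heads → SameHeadsAgreement.same-partition w m D D' bsd bsd' same-heads)
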